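{- Let $T$ be a triangulation of a compact PL manifold $M$ of dimension $d$ with boundary (not necessarily orientable). Then for any labelling $L:V(T)\to\{1,2,\ldots,d+1\}$ with $\deg_2(L,\partial T)\ne0$, the triangulation $T$ contains at least one fully colored simplex (a $d$-simplex whose vertices carry all the labels $1,\ldots,d+1$).
   Context: Let $P\subset\mathbb{R}^d$ be a $d$-simplex with vertices $p_1,\ldots,p_{d+1}$ and $f_{L,P}:M\to\mathbb{R}^d$ the piecewise linear map sending each vertex $v$ of $T$ to $p_{L(v)}$, affine on each simplex of $T$; it maps $\partial M$ into $\partial P$. $\deg_2(L,\partial T)\in\{0,1\}$ is the degree modulo 2 of $f_{L,P}|_{\partial M}:\partial M\to\partial P$ (the parity of the number of preimages of a generic point of $\partial P$). -}

module Defs where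

open import Data.Nat using (ℕ; zero; suc; _≤_; _%_)
open import Data.Fin using (Fin; fromℕ)
open import Data.Fin.Properties using (any?; all?) renaming (_≟_ to _≟ᶠ_)
open import Data.Fin.Subset using (Subset; _∈_; _⊆_; ∣_∣; inside; outside)
open import Data.Fin.Subset.Properties using (_∈?_; _⊆?_)
open import Data.List using (List; []; _∷_; map; _++_; filter; length)
open import Data.List.Relation.Unary.All using (All)
open import Data.List.Relation.Unary.Any using (Any)
open import Data.List.Relation.Unary.Unique.Propositional using (Unique)
import Data.List.Membership.Propositional as L
open import Data.Vec using (_∷_; [])
open import Data.Product using (Σ; ∃; _×_; _,_)
open import Data.Nat.Properties using () renaming (_≟_ to _≟ℕ_)
open import Relation.Binary.PropositionalEquality using (_≡_; _≢_)
open import Relation.Nullary using (Dec; ¬?)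
open import Relation.Nullary.Decidable using (_×-dec_; _→-dec_)

allSubsets : (n : ℕ) → List (Subset n)
allSubsets zero = [] ∷ []
allSubsets (suc n) = map (outside ∷_) (allSubsets n) ++ map (inside ∷_) (allSubsets n)

cofaceCount : {n : ℕ} → List (Subset n) → Subset n → ℕ
cofaceCount facets σ = length (filter (σ ⊆?_) facets)

-- A finite triangulation of a compact d-dimensional manifold with boundary,
-- on the vertex set Fin n, recorded combinatorially by its list of
-- d-simplices (facets), each a (d+1)-element set of vertices.
-- Manifold-with-boundary condition used: every (d-1)-simplex of T lies in
-- one or two d-simplices (pseudomanifold with boundary); the boundary
-- complex ∂T consists of the (d-1)-simplices lying in exactly one facet.
record Triangulation (d n : ℕ) : Set where
  field
    facets         : List (Subset n)
    facets-unique  : Unique facets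
    facet-size     : All (λ F → ∣ F ∣ ≡ suc d) facets
    covers         : ∀ (v : Fin n) → Any (v ∈_) facets
    pseudomanifold : ∀ (σ : Subset n) → ∣ σ ∣ ≡ d →
                     1 ≤ cofaceCount facets σ → cofaceCount facets σ ≤ 2

open Triangulation public

-- Labellings L : V(T) → {1,…,d+1}, labels encoded as Fin (suc d).
Labelling : ℕ → ℕ → Set
Labelling d n = Fin n → Fin (suc d)

IsBoundaryFace : ∀ {d n} → Triangulation d n → Subset n → Set
IsBoundaryFace {d} T σ = ∣ σ ∣ ≡ d × cofaceCount (facets T) σ ≡ 1

-- σ is mapped by f_{L,P} onto the facet of P opposite the vertex p_{d+1}
-- (i.e. its labels are exactly 1,…,d: every label other than the last occurs).
MapsOntoLastFacet : ∀ {d n} → Labelling d n → Subset n → Set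
MapsOntoLastFacet {d} L σ = ∀ (j : Fin (suc d)) → j ≢ fromℕ d →
                            ∃ λ (v : _) → v ∈ σ × L v ≡ j

BoundaryPreimage : ∀ {d n} → Triangulation d n → Labelling d n → Subset n → Set
BoundaryPreimage T L σ = IsBoundaryFace T σ × MapsOntoLastFacet L σ

boundaryPreimage? : ∀ {d n} (T : Triangulation d n) (L : Labelling d n) (σ : Subset n) →
                    Dec (BoundaryPreimage T L σ)
boundaryPreimage? {d} T L σ =
  ((∣ σ ∣ ≟ℕ d) ×-dec (cofaceCount (facets T) σ ≟ℕ 1)) ×-dec
  all? (λ j → ¬? (j ≟ᶠ fromℕ d) →-dec any? (λ v → (v ∈? σ) ×-dec (L v ≟ᶠ j)))

-- deg₂(L, ∂T): parity of the number of preimages under f_{L,P}|∂M of a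
-- generic point in the interior of the facet of ∂P opposite p_{d+1}, i.e.
-- the number of boundary (d-1)-simplices labelled exactly {1,…,d}, mod 2.
deg₂ : ∀ {d n} → Triangulation d n → Labelling d n → ℕ
deg₂ {n = n} T L = length (filter (boundaryPreimage? T L) (allSubsets n)) % 2

FullyColoured : ∀ {d n} → Triangulation d n → Labelling d n → Subset n → Set
FullyColoured {d} T L F =
  F L.∈ facets T × (∀ (j : Fin (suc d)) → ∃ λ (v : _) → v ∈ F × L v ≡ j)

module Submission where

-- Call a d-element vertex set σ a door when its labels are exactly 1,…,d.  We count
-- the incidences (σ, F) between doors σ and facets F ⊇ σ in two ways, modulo 2.
--  * By doors: by the pseudomanifold condition a door lies in exactly one facet if it
--    is a boundary face and in zero or two facets otherwise, so the total has the
--    parity of the number of boundary doors, which is deg₂(L, ∂T), hence odd.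
--  * By facets: the doors of F are the transversals of the labels 1,…,d in F, and
--    there are ∏ₐ mult(a) of them, mult(a) being the number of vertices of F labelled
--    a.  If this product is odd, every label 1,…,d occurs an odd number of times in F;
--    as F has d+1 vertices, the label d+1 then occurs an odd number of times too.
-- So some facet has an odd number of doors, and that facet is fully coloured.

open import Defs
open import Data.Bool.Base using (true; false; if_then_else_)
open import Data.Empty using (⊥-elim)
open import Data.Fin.Base using (Fin; zero; suc; fromℕ; punchIn)
open import Data.Fin.Properties using (_≟_; all?; any?; punchInᵢ≢i)
open import Data.Fin.Subset
  using (Subset; Side; _∈_; _∉_; _⊆_; ∣_∣; inside; outside; ⊥; ⊤; _─_; _-_; ⁅_⁆; Empty)
open import Data.Fin.Subset.Properties
  using (_∈?_; _⊆?_; nonempty?; Empty-unique; ∉⊥; ∈⊤; ∣⊥∣≡0; ∣⊤∣≡n; x∈⁅x⁆; p─⊥≡p; p─q⊆p;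
         x∈p∧x≢y⇒x∈p-y; out⊆-⇔; in⊆in-⇔; ⊆-refl)
open import Data.List.Base using (List; []; _∷_; _++_; map; filter; length)
open import Data.List.Properties using (map-++; map-∘; map-cong)
import Data.List.Membership.Propositional as List
open import Data.List.Relation.Unary.Any using (here; there)
import Data.List.Relation.Unary.All as All
open import Data.Nat.Base using (ℕ; zero; suc; _+_; _*_; _%_; _≤_; z≤n; s≤s; parity)
open import Data.Nat.ListAction using (sum)
open import Data.Nat.ListAction.Properties using (sum-++)
open import Data.Nat.Properties
  using (+-identityʳ; +-comm; *-distribˡ-+; *-zeroʳ; ≤-reflexive; ≤-trans; n≤1+n; 1+n≰n;
         suc-injective; +-0-commutativeMonoid; +-commutativeSemigroup; module ≤-Reasoning)
  renaming (_≟_ to _≟ℕ_)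
open import Algebra.Properties.CommutativeSemigroup +-commutativeSemigroup
  using () renaming (interchange to +-interchange)
open import Algebra.Properties.CommutativeMonoid.Sum +-0-commutativeMonoid
  using (sum-syntax; sum-remove; sum-replicate-zero) renaming (∑-distrib-+ to ∑<-distrib-+)
open import Data.Parity.Base using (0ℙ; 1ℙ) renaming (_+_ to _+ℙ_)
open import Data.Parity.Properties using (+-homo-+; *-homo-*; +-cancelʳ-≡)
open import Data.Product using (∃; _×_; _,_; proj₁; proj₂)
open import Data.Product.Function.NonDependent.Propositional using (_×-⇔_)
open import Data.Vec.Base using ([]; _∷_; here; there)
open import Function.Base using (_∘_)
open import Function.Bundles using (_⇔_; mk⇔; Equivalence)
import Function.Properties.Equivalence as ⇔
open import Relation.Binary.PropositionalEquality
  using (_≡_; _≢_; refl; sym; trans; cong; cong₂; _≗_; module ≡-Reasoning)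
open import Relation.Nullary using (Dec; yes; no; does; ¬_; ¬?)
open import Relation.Nullary.Decidable using (dec-true; dec-false; _×-dec_; _→-dec_)

private
  variable
    n K : ℕ
    X : Set

𝟙 : {P : Set} → Dec P → ℕ
𝟙 p = if does p then 1 else 0

𝟙-yes : {P : Set} (p : Dec P) → P → 𝟙 p ≡ 1
𝟙-yes p x rewrite dec-true p x = refl

𝟙-no : {P : Set} (p : Dec P) → ¬ P → 𝟙 p ≡ 0
𝟙-no p ¬x rewrite dec-false p ¬x = refl

𝟙-cong : {P Q : Set} → P ⇔ Q → (p : Dec P) (q : Dec Q) → 𝟙 p ≡ 𝟙 q
𝟙-cong P⇔Q (yes x) q  = sym (𝟙-yes q (Equivalence.to P⇔Q x))
𝟙-cong P⇔Q (no ¬x) q  = sym (𝟙-no q (¬x ∘ Equivalence.from P⇔Q))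

%2≢0⇒odd : ∀ m → m % 2 ≢ 0 → parity m ≡ 1ℙ
%2≢0⇒odd zero          m%2≢0 = ⊥-elim (m%2≢0 refl)
%2≢0⇒odd (suc zero)    m%2≢0 = refl
%2≢0⇒odd (suc (suc m)) m%2≢0 = %2≢0⇒odd m m%2≢0

odd⇒positive : ∀ {m} → parity m ≡ 1ℙ → 1 ≤ m
odd⇒positive {suc m} _ = s≤s z≤n

-- A count known to be 1 or 2 (when positive) is odd exactly when it equals 1;
-- this is how the pseudomanifold condition enters the argument.
parity-one-or-two : ∀ c → (1 ≤ c → c ≤ 2) → parity c ≡ parity (𝟙 (c ≟ℕ 1))
parity-one-or-two 0             _     = refl
parity-one-or-two 1             _     = refl
parity-one-or-two 2             _     = refl
parity-one-or-two (suc (suc (suc c))) c≤2 with c≤2 (s≤s z≤n)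
... | s≤s (s≤s ())

listSum : List X → (X → ℕ) → ℕ
listSum xs f = sum (map f xs)

syntax listSum xs (λ x → e) = ∑[ x ∈ xs ] e

∑-++ : (xs ys : List X) (f : X → ℕ) →
       ∑[ x ∈ xs ++ ys ] f x ≡ ∑[ x ∈ xs ] f x + ∑[ x ∈ ys ] f x
∑-++ xs ys f = trans (cong sum (map-++ f xs ys)) (sum-++ (map f xs) (map f ys))

∑-map : {Y : Set} (g : X → Y) (xs : List X) (f : Y → ℕ) →
        ∑[ y ∈ map g xs ] f y ≡ ∑[ x ∈ xs ] f (g x)
∑-map g xs f = cong sum (sym (map-∘ xs))

∑-cong : {f g : X → ℕ} → f ≗ g → (xs : List X) → ∑[ x ∈ xs ] f x ≡ ∑[ x ∈ xs ] g x
∑-cong f≗g xs = cong sum (map-cong f≗g xs)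

∑-zero : (xs : List X) → ∑[ x ∈ xs ] 0 ≡ 0
∑-zero []       = refl
∑-zero (x ∷ xs) = ∑-zero xs

∑-distrib-+ : (xs : List X) (f g : X → ℕ) →
              ∑[ x ∈ xs ] (f x + g x) ≡ ∑[ x ∈ xs ] f x + ∑[ x ∈ xs ] g x
∑-distrib-+ []       f g = refl
∑-distrib-+ (x ∷ xs) f g = begin
  (f x + g x) + ∑[ y ∈ xs ] (f y + g y)               ≡⟨ cong (f x + g x +_) (∑-distrib-+ xs f g) ⟩
  (f x + g x) + (∑[ y ∈ xs ] f y + ∑[ y ∈ xs ] g y)   ≡⟨ +-interchange (f x) (g x) _ _ ⟩
  (f x + ∑[ y ∈ xs ] f y) + (g x + ∑[ y ∈ xs ] g y)   ∎
  where open ≡-Reasoning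

∑-swap : {Y : Set} (xs : List X) (ys : List Y) (f : X → Y → ℕ) →
         ∑[ x ∈ xs ] ∑[ y ∈ ys ] f x y ≡ ∑[ y ∈ ys ] ∑[ x ∈ xs ] f x y
∑-swap []       ys f = sym (∑-zero ys)
∑-swap (x ∷ xs) ys f = begin
  ∑[ y ∈ ys ] f x y + ∑[ x′ ∈ xs ] ∑[ y ∈ ys ] f x′ y   ≡⟨ cong (∑[ y ∈ ys ] f x y +_) (∑-swap xs ys f) ⟩
  ∑[ y ∈ ys ] f x y + ∑[ y ∈ ys ] ∑[ x′ ∈ xs ] f x′ y   ≡⟨ sym (∑-distrib-+ ys (f x) _) ⟩
  ∑[ y ∈ ys ] (f x y + ∑[ x′ ∈ xs ] f x′ y)             ∎
  where open ≡-Reasoning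

∑-parity-cong : {f g : X → ℕ} → (∀ x → parity (f x) ≡ parity (g x)) → (xs : List X) →
                parity (∑[ x ∈ xs ] f x) ≡ parity (∑[ x ∈ xs ] g x)
∑-parity-cong f~g []                = refl
∑-parity-cong {f = f} {g} f~g (x ∷ xs) = begin
  parity (f x + ∑[ y ∈ xs ] f y)               ≡⟨ +-homo-+ (f x) _ ⟩
  parity (f x) +ℙ parity (∑[ y ∈ xs ] f y)     ≡⟨ cong₂ _+ℙ_ (f~g x) (∑-parity-cong f~g xs) ⟩
  parity (g x) +ℙ parity (∑[ y ∈ xs ] g y)     ≡⟨ sym (+-homo-+ (g x) _) ⟩
  parity (g x + ∑[ y ∈ xs ] g y)               ∎
  where open ≡-Reasoning

odd-∑⇒odd-term : (xs : List X) (f : X → ℕ) → parity (∑[ x ∈ xs ] f x) ≡ 1ℙ →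
                 ∃ λ x → x List.∈ xs × parity (f x) ≡ 1ℙ
odd-∑⇒odd-term []       f ()
odd-∑⇒odd-term (x ∷ xs) f odd with parity (f x) in fx-parity
... | 1ℙ = x , here refl , fx-parity
... | 0ℙ with odd-∑⇒odd-term xs f (trans (sym (cong (_+ℙ parity (∑[ y ∈ xs ] f y)) fx-parity))
                                          (trans (sym (+-homo-+ (f x) _)) odd))
...   | y , y∈xs , fy-parity = y , there y∈xs , fy-parity

count : {P : X → Set} → (∀ x → Dec (P x)) → List X → ℕ
count P? xs = ∑[ x ∈ xs ] 𝟙 (P? x)

length-filter≡count : {P : X → Set} (P? : ∀ x → Dec (P x)) (xs : List X) →
                      length (filter P? xs) ≡ count P? xs
length-filter≡count P? []       = refl
length-filter≡count P? (x ∷ xs) with does (P? x)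
... | true  = cong suc (length-filter≡count P? xs)
... | false = length-filter≡count P? xs

count-cong : {P Q : X → Set} (P? : ∀ x → Dec (P x)) (Q? : ∀ x → Dec (Q x)) →
             (∀ x → P x ⇔ Q x) → (xs : List X) → count P? xs ≡ count Q? xs
count-cong P? Q? P⇔Q = ∑-cong (λ x → 𝟙-cong (P⇔Q x) (P? x) (Q? x))

count-none : {P : X → Set} (P? : ∀ x → Dec (P x)) → (∀ x → ¬ P x) → (xs : List X) →
             count P? xs ≡ 0
count-none P? ¬P xs = trans (∑-cong (λ x → 𝟙-no (P? x) (¬P x)) xs) (∑-zero xs)

count-allSubsets : {P : Subset (suc n) → Set} (P? : ∀ σ → Dec (P σ)) →
                   count P? (allSubsets (suc n)) ≡
                   count (P? ∘ (outside ∷_)) (allSubsets n) + count (P? ∘ (inside ∷_)) (allSubsets n)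
count-allSubsets {n} P? = begin
  count P? (map (outside ∷_) S ++ map (inside ∷_) S)
    ≡⟨ ∑-++ (map (outside ∷_) S) (map (inside ∷_) S) _ ⟩
  count P? (map (outside ∷_) S) + count P? (map (inside ∷_) S)
    ≡⟨ cong₂ _+_ (∑-map (outside ∷_) S _) (∑-map (inside ∷_) S _) ⟩
  count (P? ∘ (outside ∷_)) S + count (P? ∘ (inside ∷_)) S ∎
  where
  open ≡-Reasoning
  S : List (Subset n)
  S = allSubsets n

x∈p─q⇒x∉q : {x : Fin n} (p q : Subset n) → x ∈ p ─ q → x ∉ q
x∈p─q⇒x∉q (_ ∷ p) (outside ∷ q) here          ()
x∈p─q⇒x∉q (_ ∷ p) (_ ∷ q)       (there x∈p─q) (there x∈q) = x∈p─q⇒x∉q p q x∈p─q x∈q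

x∈p-y⇒x≢y : {x y : Fin n} (p : Subset n) → x ∈ p - y → x ≢ y
x∈p-y⇒x≢y {x = x} p x∈p-x refl = x∈p─q⇒x∉q p ⁅ x ⁆ x∈p-x (x∈⁅x⁆ x)

∣p∣≡1+∣p-x∣ : {x : Fin n} {p : Subset n} → x ∈ p → ∣ p ∣ ≡ suc ∣ p - x ∣
∣p∣≡1+∣p-x∣ {p = inside ∷ p}  here        = cong (suc ∘ ∣_∣) (sym (p─⊥≡p p))
∣p∣≡1+∣p-x∣ {p = inside ∷ p}  (there x∈p) = cong suc (∣p∣≡1+∣p-x∣ x∈p)
∣p∣≡1+∣p-x∣ {p = outside ∷ p} (there x∈p) = ∣p∣≡1+∣p-x∣ x∈p

x∉p⇒p-x≡p : {x : Fin n} {p : Subset n} → x ∉ p → p - x ≡ p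
x∉p⇒p-x≡p {x = zero}  {outside ∷ p} _   = cong (outside ∷_) (p─⊥≡p p)
x∉p⇒p-x≡p {x = zero}  {inside ∷ p}  x∉p = ⊥-elim (x∉p here)
x∉p⇒p-x≡p {x = suc x} {b ∷ p}       x∉p = cong (b ∷_) (x∉p⇒p-x≡p (x∉p ∘ there))

∣p∣≤1+∣p-x∣ : (p : Subset n) (x : Fin n) → ∣ p ∣ ≤ suc ∣ p - x ∣
∣p∣≤1+∣p-x∣ p x with x ∈? p
... | yes x∈p = ≤-reflexive (∣p∣≡1+∣p-x∣ x∈p)
... | no  x∉p rewrite x∉p⇒p-x≡p x∉p = n≤1+n ∣ p ∣

∏ : Subset K → (Fin K → ℕ) → ℕ
∏ []            f = 1
∏ (inside ∷ A)  f = f zero * ∏ A (f ∘ suc)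
∏ (outside ∷ A) f = ∏ A (f ∘ suc)

syntax ∏ A (λ a → e) = ∏[ a ∈ A ] e

∏-cong : (A : Subset K) {f g : Fin K → ℕ} → (∀ {a} → a ∈ A → f a ≡ g a) →
         ∏[ a ∈ A ] f a ≡ ∏[ a ∈ A ] g a
∏-cong []            f≡g = refl
∏-cong (inside ∷ A)  f≡g = cong₂ _*_ (f≡g here) (∏-cong A (f≡g ∘ there))
∏-cong (outside ∷ A) f≡g = ∏-cong A (f≡g ∘ there)

∏-⊥ : (f : Fin K → ℕ) → ∏[ a ∈ ⊥ ] f a ≡ 1
∏-⊥ {zero}  f = refl
∏-⊥ {suc K} f = ∏-⊥ (f ∘ suc)

∏-zero : {A : Subset K} {a : Fin K} (f : Fin K → ℕ) → a ∈ A → f a ≡ 0 → ∏[ b ∈ A ] f b ≡ 0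
∏-zero {A = inside ∷ A}  f here        fa≡0 rewrite fa≡0 = refl
∏-zero {A = inside ∷ A}  f (there a∈A) fa≡0 =
  trans (cong (f zero *_) (∏-zero (f ∘ suc) a∈A fa≡0)) (*-zeroʳ (f zero))
∏-zero {A = outside ∷ A} f (there a∈A) fa≡0 = ∏-zero (f ∘ suc) a∈A fa≡0

-- Raising one factor ℓ ∈ A by one adds the product over A - ℓ (expand the factor).
∏-insert : {A : Subset K} {ℓ : Fin K} (f : Fin K → ℕ) → ℓ ∈ A →
           ∏[ a ∈ A ] (𝟙 (ℓ ≟ a) + f a) ≡ ∏[ a ∈ A ] f a + ∏[ a ∈ A - ℓ ] f a
∏-insert {A = inside ∷ A} f here = begin
  (1 + f zero) * ∏ A (f ∘ suc)                        ≡⟨ +-comm (∏ A (f ∘ suc)) _ ⟩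
  f zero * ∏ A (f ∘ suc) + ∏ A (f ∘ suc)              ≡⟨ cong (λ B → f zero * ∏ A (f ∘ suc) + ∏ B (f ∘ suc)) (sym (p─⊥≡p A)) ⟩
  f zero * ∏ A (f ∘ suc) + ∏ (A ─ ⊥) (f ∘ suc)        ∎
  where open ≡-Reasoning
∏-insert {A = inside ∷ A} f (there ℓ∈A) =
  trans (cong (f zero *_) (∏-insert (f ∘ suc) ℓ∈A)) (*-distribˡ-+ (f zero) _ _)
∏-insert {A = outside ∷ A} f (there ℓ∈A) = ∏-insert (f ∘ suc) ℓ∈A

∏-avoid : {A : Subset K} {ℓ : Fin K} (f : Fin K → ℕ) → ℓ ∉ A →
          ∏[ a ∈ A ] (𝟙 (ℓ ≟ a) + f a) ≡ ∏[ a ∈ A ] f a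
∏-avoid {A = A} {ℓ} f ℓ∉A =
  ∏-cong A λ {a} a∈A → cong (_+ f a) (𝟙-no (ℓ ≟ a) λ { refl → ℓ∉A a∈A })

odd-*⇒odd : ∀ m k → parity (m * k) ≡ 1ℙ → parity m ≡ 1ℙ × parity k ≡ 1ℙ
odd-*⇒odd m k odd with parity m | parity k | trans (sym (*-homo-* m k)) odd
... | 1ℙ | 1ℙ | _ = refl , refl

odd-∏⇒odd-factor : (A : Subset K) (f : Fin K → ℕ) → parity (∏[ a ∈ A ] f a) ≡ 1ℙ →
                   ∀ {a} → a ∈ A → parity (f a) ≡ 1ℙ
odd-∏⇒odd-factor (inside ∷ A) f odd here =
  proj₁ (odd-*⇒odd (f zero) _ odd)
odd-∏⇒odd-factor (inside ∷ A) f odd (there a∈A) =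
  odd-∏⇒odd-factor A (f ∘ suc) (proj₂ (odd-*⇒odd (f zero) _ odd)) a∈A
odd-∏⇒odd-factor (outside ∷ A) f odd (there a∈A) =
  odd-∏⇒odd-factor A (f ∘ suc) odd a∈A

mult : (Fin n → Fin K) → Subset n → Fin K → ℕ
mult L []            a = 0
mult L (outside ∷ F) a = mult (L ∘ suc) F a
mult L (inside ∷ F)  a = 𝟙 (L zero ≟ a) + mult (L ∘ suc) F a

∑-𝟙 : (ℓ : Fin K) → ∑[ a < K ] 𝟙 (ℓ ≟ a) ≡ 1
∑-𝟙 {suc K} zero = cong suc (sum-replicate-zero K)
∑-𝟙 (suc ℓ)      = ∑-𝟙 ℓ

∑-mult : (L : Fin n → Fin K) (F : Subset n) → ∑[ a < K ] mult L F a ≡ ∣ F ∣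
∑-mult {K = K} L []   = sum-replicate-zero K
∑-mult L (outside ∷ F) = ∑-mult (L ∘ suc) F
∑-mult L (inside ∷ F)  =
  trans (∑<-distrib-+ (λ a → 𝟙 (L zero ≟ a)) (mult (L ∘ suc) F))
        (cong₂ _+_ (∑-𝟙 (L zero)) (∑-mult (L ∘ suc) F))

mult-pos : (L : Fin n → Fin K) (F : Subset n) {a : Fin K} →
           1 ≤ mult L F a → ∃ λ v → v ∈ F × L v ≡ a
mult-pos L (outside ∷ F) pos with mult-pos (L ∘ suc) F pos
... | v , v∈F , Lv≡a = suc v , there v∈F , Lv≡a
mult-pos L (inside ∷ F) {a} pos with L zero ≟ a
... | yes L0≡a = zero , here , L0≡a
... | no  _ with mult-pos (L ∘ suc) F pos
...   | v , v∈F , Lv≡a = suc v , there v∈F , Lv≡a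

parity-∑-odd : (f : Fin K → ℕ) → (∀ j → parity (f j) ≡ 1ℙ) → parity (∑[ j < K ] f j) ≡ parity K
parity-∑-odd {zero}  f odd = refl
parity-∑-odd {suc K} f odd = begin
  parity (f zero + ∑[ j < K ] f (suc j))          ≡⟨ +-homo-+ (f zero) _ ⟩
  parity (f zero) +ℙ parity (∑[ j < K ] f (suc j)) ≡⟨ cong₂ _+ℙ_ (odd zero) (parity-∑-odd (f ∘ suc) (odd ∘ suc)) ⟩
  1ℙ +ℙ parity K                                  ≡⟨ sym (+-homo-+ 1 K) ⟩
  parity (suc K)                                  ∎
  where open ≡-Reasoning

odd-remaining-label : (L : Fin n → Fin (suc K)) (F : Subset n) (ℓ : Fin (suc K)) →
                      ∣ F ∣ ≡ suc K → (∀ a → a ≢ ℓ → parity (mult L F a) ≡ 1ℙ) →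
                      parity (mult L F ℓ) ≡ 1ℙ
odd-remaining-label {K = K} L F ℓ size odd = +-cancelʳ-≡ (parity K) _ _ (begin
  parity (m ℓ) +ℙ parity K                              ≡⟨ cong (parity (m ℓ) +ℙ_) (sym odd-rest) ⟩
  parity (m ℓ) +ℙ parity (∑[ j < K ] m (punchIn ℓ j))   ≡⟨ sym (+-homo-+ (m ℓ) _) ⟩
  parity (m ℓ + ∑[ j < K ] m (punchIn ℓ j))             ≡⟨ cong parity (sym (sum-remove m)) ⟩
  parity (∑[ a < suc K ] m a)                           ≡⟨ cong parity (trans (∑-mult L F) size) ⟩
  parity (suc K)                                        ≡⟨ +-homo-+ 1 K ⟩
  1ℙ +ℙ parity K                                        ∎)
  where
  open ≡-Reasoning
  m : Fin (suc K) → ℕ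
  m = mult L F
  odd-rest : parity (∑[ j < K ] m (punchIn ℓ j)) ≡ parity K
  odd-rest = parity-∑-odd (m ∘ punchIn ℓ) (λ j → odd (punchIn ℓ j) (punchInᵢ≢i ℓ j))

Covers : (Fin n → Fin K) → Subset K → Subset n → Set
Covers L A σ = ∀ a → a ∈ A → ∃ λ v → v ∈ σ × L v ≡ a

covers? : (L : Fin n → Fin K) (A : Subset K) (σ : Subset n) → Dec (Covers L A σ)
covers? L A σ = all? λ a → (a ∈? A) →-dec any? λ v → (v ∈? σ) ×-dec (L v ≟ a)

covers-outside : (L : Fin (suc n) → Fin K) (A : Subset K) (σ : Subset n) →
                 Covers L A (outside ∷ σ) ⇔ Covers (L ∘ suc) A σ
covers-outside L A σ = mk⇔ to from
  where
  to : Covers L A (outside ∷ σ) → Covers (L ∘ suc) A σ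
  to covers a a∈A with covers a a∈A
  ... | suc v , there v∈σ , Lv≡a = v , v∈σ , Lv≡a
  from : Covers (L ∘ suc) A σ → Covers L A (outside ∷ σ)
  from covers a a∈A with covers a a∈A
  ... | v , v∈σ , Lv≡a = suc v , there v∈σ , Lv≡a

covers-inside : (L : Fin (suc n) → Fin K) (A : Subset K) (σ : Subset n) →
                Covers L A (inside ∷ σ) ⇔ Covers (L ∘ suc) (A - L zero) σ
covers-inside L A σ = mk⇔ to from
  where
  to : Covers L A (inside ∷ σ) → Covers (L ∘ suc) (A - L zero) σ
  to covers a a∈A-L0 with covers a (p─q⊆p A ⁅ L zero ⁆ a∈A-L0)
  ... | zero  , here       , L0≡a = ⊥-elim (x∈p-y⇒x≢y A a∈A-L0 (sym L0≡a))
  ... | suc v , there v∈σ  , Lv≡a = v , v∈σ , Lv≡a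
  from : Covers (L ∘ suc) (A - L zero) σ → Covers L A (inside ∷ σ)
  from covers a a∈A with a ≟ L zero
  ... | yes a≡L0 = zero , here , sym a≡L0
  ... | no  a≢L0 with covers a (x∈p∧x≢y⇒x∈p-y a∈A a≢L0)
  ...   | v , v∈σ , Lv≡a = suc v , there v∈σ , Lv≡a

covers⇒∣A∣≤∣σ∣ : (L : Fin n → Fin K) (A : Subset K) (σ : Subset n) → Covers L A σ → ∣ A ∣ ≤ ∣ σ ∣
covers⇒∣A∣≤∣σ∣ {K = K} L A [] covers =
  ≤-reflexive (trans (cong ∣_∣ (Empty-unique nothing-to-cover)) (∣⊥∣≡0 K))
  where
  nothing-to-cover : Empty A
  nothing-to-cover (a , a∈A) with covers a a∈A
  ... | () , _
covers⇒∣A∣≤∣σ∣ L A (outside ∷ σ) covers =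
  covers⇒∣A∣≤∣σ∣ (L ∘ suc) A σ (Equivalence.to (covers-outside L A σ) covers)
covers⇒∣A∣≤∣σ∣ L A (inside ∷ σ) covers =
  ≤-trans (∣p∣≤1+∣p-x∣ A (L zero))
          (s≤s (covers⇒∣A∣≤∣σ∣ (L ∘ suc) (A - L zero) σ (Equivalence.to (covers-inside L A σ) covers)))

-- σ is a transversal of A in F: a subset of F with exactly ∣ A ∣ vertices covering A,
-- i.e. its vertices carry the labels of A, each exactly once.
Transversal : (Fin n → Fin K) → Subset n → Subset K → Subset n → Set
Transversal L F A σ = σ ⊆ F × ∣ σ ∣ ≡ ∣ A ∣ × Covers L A σ

transversal? : (L : Fin n → Fin K) (F : Subset n) (A : Subset K) (σ : Subset n) →
               Dec (Transversal L F A σ)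
transversal? L F A σ = (σ ⊆? F) ×-dec (∣ σ ∣ ≟ℕ ∣ A ∣) ×-dec covers? L A σ

transversals : (Fin n → Fin K) → Subset n → Subset K → ℕ
transversals {n} L F A = count (transversal? L F A) (allSubsets n)

transversal-outside : (L : Fin (suc n) → Fin K) (s : Side) (F : Subset n) (A : Subset K)
                      (σ : Subset n) → Transversal L (s ∷ F) A (outside ∷ σ) ⇔ Transversal (L ∘ suc) F A σ
transversal-outside L s F A σ = ⇔.sym out⊆-⇔ ×-⇔ ⇔.refl ×-⇔ covers-outside L A σ

transversal-inside : (L : Fin (suc n) → Fin K) (F : Subset n) {A : Subset K} (σ : Subset n) →
                     L zero ∈ A →
                     Transversal L (inside ∷ F) A (inside ∷ σ) ⇔ Transversal (L ∘ suc) F (A - L zero) σ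
transversal-inside L F {A} σ L0∈A =
  ⇔.sym in⊆in-⇔ ×-⇔ mk⇔ (λ e → suc-injective (trans e size)) (λ e → trans (cong suc e) (sym size))
                ×-⇔ covers-inside L A σ
  where
  size : ∣ A ∣ ≡ suc ∣ A - L zero ∣
  size = ∣p∣≡1+∣p-x∣ L0∈A

¬transversal-inside : (L : Fin (suc n) → Fin K) (s : Side) (F : Subset n) {A : Subset K}
                      (σ : Subset n) → L zero ∉ A → ¬ Transversal L (s ∷ F) A (inside ∷ σ)
¬transversal-inside L s F {A} σ L0∉A (_ , size , covers) =
  1+n≰n (begin
    suc ∣ σ ∣       ≡⟨ size ⟩
    ∣ A ∣           ≡⟨ cong ∣_∣ (sym (x∉p⇒p-x≡p L0∉A)) ⟩
    ∣ A - L zero ∣  ≤⟨ covers⇒∣A∣≤∣σ∣ (L ∘ suc) (A - L zero) σ (Equivalence.to (covers-inside L A σ) covers) ⟩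
    ∣ σ ∣           ∎)
  where open ≤-Reasoning

¬transversal-unused : (L : Fin (suc n) → Fin K) (F : Subset n) (A : Subset K) (σ : Subset n) →
                      ¬ Transversal L (outside ∷ F) A (inside ∷ σ)
¬transversal-unused L F A σ (σ⊆F , _) with σ⊆F here
... | ()

transversals-[] : (L : Fin 0 → Fin K) (A : Subset K) → transversals L [] A ≡ ∏[ a ∈ A ] 0
transversals-[] {K} L A with nonempty? A
... | yes (a , a∈A) = begin
  𝟙 (transversal? L [] A []) + 0  ≡⟨ +-identityʳ _ ⟩
  𝟙 (transversal? L [] A [])      ≡⟨ 𝟙-no (transversal? L [] A []) uncovered ⟩
  0                               ≡⟨ sym (∏-zero (λ _ → 0) a∈A refl) ⟩
  ∏[ b ∈ A ] 0                    ∎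
  where
  open ≡-Reasoning
  uncovered : ¬ Transversal L [] A []
  uncovered (_ , _ , covers) with covers a a∈A
  ... | () , _
... | no empty with Empty-unique empty
... | refl = begin
  𝟙 (transversal? L [] (⊥ {K}) []) + 0  ≡⟨ +-identityʳ _ ⟩
  𝟙 (transversal? L [] ⊥ [])      ≡⟨ 𝟙-yes (transversal? L [] ⊥ []) (⊆-refl , sym (∣⊥∣≡0 K) , λ a a∈⊥ → ⊥-elim (∉⊥ a∈⊥)) ⟩
  1                               ≡⟨ sym (∏-⊥ {K} (λ _ → 0)) ⟩
  ∏[ b ∈ ⊥ {K} ] 0                ∎
  where open ≡-Reasoning

-- Transversal count: the transversals of A in F are obtained by choosing, for every
-- label a ∈ A, one of the mult L F a vertices of F labelled a.
transversals≡∏ : (L : Fin n → Fin K) (F : Subset n) (A : Subset K) →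
                 transversals L F A ≡ ∏[ a ∈ A ] mult L F a
transversals≡∏ L [] A = transversals-[] L A
transversals≡∏ {suc n} L (outside ∷ F) A = begin
  transversals L (outside ∷ F) A
    ≡⟨ count-allSubsets (transversal? L (outside ∷ F) A) ⟩
  count (T? ∘ (outside ∷_)) S + count (T? ∘ (inside ∷_)) S
    ≡⟨ cong₂ _+_ (count-cong (T? ∘ (outside ∷_)) (transversal? (L ∘ suc) F A) (transversal-outside L outside F A) S)
                 (count-none (T? ∘ (inside ∷_)) (¬transversal-unused L F A) S) ⟩
  transversals (L ∘ suc) F A + 0
    ≡⟨ +-identityʳ _ ⟩
  transversals (L ∘ suc) F A
    ≡⟨ transversals≡∏ (L ∘ suc) F A ⟩
  ∏[ a ∈ A ] mult (L ∘ suc) F a ∎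
  where
  open ≡-Reasoning
  S : List (Subset n)
  S = allSubsets n
  T? : (σ : Subset (suc n)) → Dec (Transversal L (outside ∷ F) A σ)
  T? = transversal? L (outside ∷ F) A
transversals≡∏ {suc n} L (inside ∷ F) A with L zero ∈? A
... | yes L0∈A = begin
  transversals L (inside ∷ F) A
    ≡⟨ count-allSubsets (transversal? L (inside ∷ F) A) ⟩
  count (T? ∘ (outside ∷_)) S + count (T? ∘ (inside ∷_)) S
    ≡⟨ cong₂ _+_ (count-cong (T? ∘ (outside ∷_)) (transversal? (L ∘ suc) F A) (transversal-outside L inside F A) S)
                 (count-cong (T? ∘ (inside ∷_)) (transversal? (L ∘ suc) F (A - L zero))
                   (λ σ → transversal-inside L F σ L0∈A) S) ⟩
  transversals (L ∘ suc) F A + transversals (L ∘ suc) F (A - L zero)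
    ≡⟨ cong₂ _+_ (transversals≡∏ (L ∘ suc) F A) (transversals≡∏ (L ∘ suc) F (A - L zero)) ⟩
  ∏[ a ∈ A ] mult (L ∘ suc) F a + ∏[ a ∈ A - L zero ] mult (L ∘ suc) F a
    ≡⟨ sym (∏-insert (mult (L ∘ suc) F) L0∈A) ⟩
  ∏[ a ∈ A ] mult L (inside ∷ F) a ∎
  where
  open ≡-Reasoning
  S : List (Subset n)
  S = allSubsets n
  T? : (σ : Subset (suc n)) → Dec (Transversal L (inside ∷ F) A σ)
  T? = transversal? L (inside ∷ F) A
... | no L0∉A = begin
  transversals L (inside ∷ F) A
    ≡⟨ count-allSubsets (transversal? L (inside ∷ F) A) ⟩
  count (T? ∘ (outside ∷_)) S + count (T? ∘ (inside ∷_)) S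
    ≡⟨ cong₂ _+_ (count-cong (T? ∘ (outside ∷_)) (transversal? (L ∘ suc) F A) (transversal-outside L inside F A) S)
                 (count-none (T? ∘ (inside ∷_)) (λ σ → ¬transversal-inside L inside F σ L0∉A) S) ⟩
  transversals (L ∘ suc) F A + 0
    ≡⟨ +-identityʳ _ ⟩
  transversals (L ∘ suc) F A
    ≡⟨ transversals≡∏ (L ∘ suc) F A ⟩
  ∏[ a ∈ A ] mult (L ∘ suc) F a
    ≡⟨ sym (∏-avoid (mult (L ∘ suc) F) L0∉A) ⟩
  ∏[ a ∈ A ] mult L (inside ∷ F) a ∎
  where
  open ≡-Reasoning
  S : List (Subset n)
  S = allSubsets n
  T? : (σ : Subset (suc n)) → Dec (Transversal L (inside ∷ F) A σ)
  T? = transversal? L (inside ∷ F) A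

firstLabels : (d : ℕ) → Subset (suc d)
firstLabels d = ⊤ - fromℕ d

∣firstLabels∣ : (d : ℕ) → ∣ firstLabels d ∣ ≡ d
∣firstLabels∣ d = sym (suc-injective (trans (sym (∣⊤∣≡n (suc d))) (∣p∣≡1+∣p-x∣ (∈⊤ {x = fromℕ d}))))

∈firstLabels : {d : ℕ} {a : Fin (suc d)} → a ∈ firstLabels d ⇔ a ≢ fromℕ d
∈firstLabels = mk⇔ (x∈p-y⇒x≢y ⊤) (x∈p∧x≢y⇒x∈p-y ∈⊤)

mapsOntoLastFacet⇔covers : {d : ℕ} (L : Labelling d n) (σ : Subset n) →
                           MapsOntoLastFacet L σ ⇔ Covers L (firstLabels d) σ
mapsOntoLastFacet⇔covers L σ =
  mk⇔ (λ maps a a∈ → maps a (Equivalence.to ∈firstLabels a∈))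
      (λ covers j j≢last → covers j (Equivalence.from ∈firstLabels j≢last))

-- A door is a d-element vertex set labelled exactly 1,…,d; boundary doors are the
-- preimages counted by deg₂, and the doors of a facet are its door faces.
Door : {d : ℕ} → Labelling d n → Subset n → Set
Door {d = d} L σ = ∣ σ ∣ ≡ d × MapsOntoLastFacet L σ

door? : {d : ℕ} (L : Labelling d n) (σ : Subset n) → Dec (Door L σ)
door? {d = d} L σ = (∣ σ ∣ ≟ℕ d) ×-dec
  all? (λ j → ¬? (j ≟ fromℕ d) →-dec any? (λ v → (v ∈? σ) ×-dec (L v ≟ j)))

doorsOf : {d : ℕ} → Labelling d n → Subset n → ℕ
doorsOf {n} L F = count (λ σ → (σ ⊆? F) ×-dec door? L σ) (allSubsets n)

doorsOf≡∏ : {d : ℕ} (L : Labelling d n) (F : Subset n) →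
            doorsOf L F ≡ ∏[ a ∈ firstLabels d ] mult L F a
doorsOf≡∏ {n} {d} L F = trans
  (count-cong (λ σ → (σ ⊆? F) ×-dec door? L σ) (transversal? L F (firstLabels d))
              door⇔transversal (allSubsets n))
  (transversals≡∏ L F (firstLabels d))
  where
  door⇔transversal : ∀ σ → (σ ⊆ F × Door L σ) ⇔ Transversal L F (firstLabels d) σ
  door⇔transversal σ = ⇔.refl ×-⇔ mk⇔ (λ e → trans e (sym (∣firstLabels∣ d)))
                                        (λ e → trans e (∣firstLabels∣ d))
                              ×-⇔ mapsOntoLastFacet⇔covers L σ

-- Modulo 2, a door lies in one facet if it is a boundary face and in no or two
-- facets otherwise (pseudomanifold condition); non-doors contribute nothing.
cofacets-of-door : {d : ℕ} (T : Triangulation d n) (L : Labelling d n) (σ : Subset n) →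
                   (door : Dec (Door L σ)) →
                   parity (count (λ F → (σ ⊆? F) ×-dec door) (facets T)) ≡
                   parity (𝟙 (boundaryPreimage? T L σ))
cofacets-of-door T L σ (no ¬door) = cong parity (trans
  (count-none (λ F → (σ ⊆? F) ×-dec no ¬door) (λ F → ¬door ∘ proj₂) (facets T))
  (sym (𝟙-no (boundaryPreimage? T L σ) λ ((size , _) , maps) → ¬door (size , maps))))
cofacets-of-door T L σ (yes door@(size , maps)) = begin
  parity (count (λ F → (σ ⊆? F) ×-dec yes door) (facets T))
    ≡⟨ cong parity (count-cong (λ F → (σ ⊆? F) ×-dec yes door) (σ ⊆?_)
                                  (λ F → mk⇔ proj₁ (_, door)) (facets T)) ⟩
  parity (count (σ ⊆?_) (facets T))
    ≡⟨ cong parity (sym (length-filter≡count (σ ⊆?_) (facets T))) ⟩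
  parity c
    ≡⟨ parity-one-or-two c (pseudomanifold T σ size) ⟩
  parity (𝟙 (c ≟ℕ 1))
    ≡⟨ cong parity (𝟙-cong (mk⇔ (λ c≡1 → (size , c≡1) , maps) (proj₂ ∘ proj₁))
                            (c ≟ℕ 1) (boundaryPreimage? T L σ)) ⟩
  parity (𝟙 (boundaryPreimage? T L σ)) ∎
  where
  open ≡-Reasoning
  c : ℕ
  c = cofaceCount (facets T) σ

-- Double counting of (door, facet) incidences: the doors of all facets together
-- have the parity of the number of boundary doors, i.e. of deg₂.
∑-doorsOf-parity : {d : ℕ} (T : Triangulation d n) (L : Labelling d n) →
                   parity (∑[ F ∈ facets T ] doorsOf L F) ≡
                   parity (length (filter (boundaryPreimage? T L) (allSubsets n)))
∑-doorsOf-parity {n} T L = begin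
  parity (∑[ F ∈ facets T ] ∑[ σ ∈ S ] incidence σ F)
    ≡⟨ cong parity (∑-swap (facets T) S (λ F σ → incidence σ F)) ⟩
  parity (∑[ σ ∈ S ] ∑[ F ∈ facets T ] incidence σ F)
    ≡⟨ ∑-parity-cong (λ σ → cofacets-of-door T L σ (door? L σ)) S ⟩
  parity (count (boundaryPreimage? T L) S)
    ≡⟨ cong parity (sym (length-filter≡count (boundaryPreimage? T L) S)) ⟩
  parity (length (filter (boundaryPreimage? T L) S)) ∎
  where
  open ≡-Reasoning
  S : List (Subset n)
  S = allSubsets n
  incidence : Subset n → Subset n → ℕ
  incidence σ F = 𝟙 ((σ ⊆? F) ×-dec door? L σ)

-- A facet with an odd number of doors is fully coloured: every first label occurs an
-- odd number of times (odd product), hence so does the last one (d+1 vertices).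
odd-doors⇒fullyColoured : {d : ℕ} (T : Triangulation d n) (L : Labelling d n) {F : Subset n} →
                          F List.∈ facets T → parity (doorsOf L F) ≡ 1ℙ → FullyColoured T L F
odd-doors⇒fullyColoured {d = d} T L {F} F∈T odd =
  F∈T , λ j → mult-pos L F (odd⇒positive (all-odd j))
  where
  first-odd : ∀ a → a ≢ fromℕ d → parity (mult L F a) ≡ 1ℙ
  first-odd a a≢last = odd-∏⇒odd-factor (firstLabels d) (mult L F)
    (trans (cong parity (sym (doorsOf≡∏ L F))) odd) (Equivalence.from ∈firstLabels a≢last)
  all-odd : ∀ a → parity (mult L F a) ≡ 1ℙ
  all-odd a with a ≟ fromℕ d
  ... | yes refl   = odd-remaining-label L F (fromℕ d) (All.lookup (facet-size T) F∈T) first-odd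
  ... | no a≢last = first-odd a a≢last

-- The sum of
-- the door counts over all facets is odd, so some facet has an odd number of doors.
corollary4p5 : (d n : ℕ) → 1 ≤ d → (T : Triangulation d n) → (L : Labelling d n) →
    deg₂ T L ≢ 0 → ∃ λ (F : Subset n) → FullyColoured T L F
corollary4p5 d n _ T L deg₂≢0 = F , odd-doors⇒fullyColoured T L F∈T odd-doors
  where
  boundaryDoors : ℕ
  boundaryDoors = length (filter (boundaryPreimage? T L) (allSubsets n))

  odd-total : parity (∑[ F ∈ facets T ] doorsOf L F) ≡ 1ℙ
  odd-total = trans (∑-doorsOf-parity T L) (%2≢0⇒odd boundaryDoors deg₂≢0)

  witness : ∃ λ F → F List.∈ facets T × parity (doorsOf L F) ≡ 1ℙ
  witness = odd-∑⇒odd-term (facets T) (doorsOf L) odd-total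

  F : Subset n
  F = proj₁ witness

  F∈T : F List.∈ facets T
  F∈T = proj₁ (proj₂ witness)

  odd-doors : parity (doorsOf L F) ≡ 1ℙ
  odd-doors = proj₂ (proj₂ witness)
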